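{- Let $n \ge 1$, let $S_1, \ldots, S_n$ be finite sets with $|S_k| \ge 2$ for each $k$, let $Q = S_1 \times \cdots \times S_n$, let $\delta \in (0, 1/2]$, and let $\mathcal{A}$ be a collection of hyperplanes in $Q$, each of which has at least one fixed coordinate. Let $\alpha_k$ and $\mathbb{P}_k$ ($0 \le k \le n$) be defined from $\mathcal{A}$ and $\delta$ as in the context. If $$\frac{1}{4\delta(1-\delta)} \sum_{k=1}^n \mathbb{E}_{k-1}\big[\alpha_k(x)^2\big] < 1,$$ then $\mathcal{A}$ does not cover $Q$, i.e. $\bigcup_{A \in \mathcal{A}} A \ne Q$.
   Context: For $0 \le k \le n$ let $Q_k = S_1 \times \cdots \times S_k$ ($Q_0$ is a one-point set). A hyperplane in $Q$ is a set $A = Y_1 \times \cdots \times Y_n$ where each $Y_i$ is either $S_i$ or a single element of $S_i$; its set of fixed coordinates is $F(A) = \{k : Y_k \ne S_k\}$. A subset $X \subseteq Q_k$ is identified with $X \times S_{k+1} \times \cdots \times S_n \subseteq Q$. For $1 \le k \le n$ let $\mathcal{A}_k = \{A \in \mathcal{A} : \max F(A) = k\}$ and $B_k = \bigcup_{A \in \mathcal{A}_k} A$, regarded as a subset of $Q_k$ (possible since $F(A) \subseteq \{1,\ldots,k\}$ for $A \in \mathcal{A}_k$). Write elements of $Q_k$ as pairs $(x,y)$ with $x \in Q_{k-1}$, $y \in S_k$. For $x \in Q_{k-1}$ set $\alpha_k(x) = |\{y \in S_k : (x,y) \in B_k\}| / |S_k|$. Define probability measures $\mathbb{P}_k$ on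 $Q_k$ recursively: $\mathbb{P}_0$ is the unique probability measure on $Q_0$, and for $1 \le k \le n$ and $(x,y) \in Q_k$, $$\mathbb{P}_k(x,y) = \max\Big\{0, \frac{\alpha_k(x) - \delta}{\alpha_k(x)(1-\delta)}\Big\} \cdot \frac{\mathbb{P}_{k-1}(x)}{|S_k|} \text{ if } (x,y) \in B_k,$$ $$\mathbb{P}_k(x,y) = \min\Big\{\frac{1}{1-\alpha_k(x)}, \frac{1}{1-\delta}\Big\} \cdot \frac{\mathbb{P}_{k-1}(x)}{|S_k|} \text{ if } (x,y) \notin B_k.$$ Each $\mathbb{P}_k$ is extended to a probability measure on $Q$ uniformly, i.e. $\mathbb{P}_k(x,z) = \mathbb{P}_k(x)/(|S_{k+1}|\cdots|S_n|)$ for $x \in Q_k$, $z \in S_{k+1}\times\cdots\times S_n$. $\mathbb{E}_{k-1}[\alpha_k(x)^2]$ denotes $\sum_{x \in Q_{k-1}} \alpha_k(x)^2 \, \mathbb{P}_{k-1}(x)$.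
   Formalization: The parameter δ ranges over the rationals in $(0, 1/2]$. -}

module Defs where

open import Data.Nat as ℕ using (ℕ; zero; suc)
open import Data.Fin as Fin using (Fin; zero; suc; toℕ)
open import Data.Maybe using (Maybe; just; nothing)
open import Data.Bool using (Bool; true; false; T; _∧_; if_then_else_; not)
open import Data.List using (List; []; _∷_; map; concatMap; allFin; foldr; filter; length)
open import Data.Bool.ListAction using (all; any)
open import Data.Integer using (+_)
open import Data.Rational as ℚ using (ℚ; 0ℚ; 1ℚ; _+_; _*_; _-_; _⊔_; _⊓_)
open import Data.Rational.Properties using () renaming (_≟_ to _≟ℚ_)
open import Relation.Nullary using (yes; no)
open import Relation.Nullary.Decidable using (isYes)
open import Relation.Binary.PropositionalEquality using (_≡_; refl)
open import Function using (_∘_)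

-- Sizes: S_k = Fin (s k) for coordinates k : Fin n (0-based: Fin-index i is the
-- paper's coordinate i+1).  A point of Q = S_1 × ⋯ × S_n:
Point : (n : ℕ) → (Fin n → ℕ) → Set
Point n s = (i : Fin n) → Fin (s i)

-- A hyperplane: at coordinate i, `nothing` means Y_i = S_i, `just a` means Y_i = {a}.
Hyperplane : (n : ℕ) → (Fin n → ℕ) → Set
Hyperplane n s = (i : Fin n) → Maybe (Fin (s i))

Fixed : ∀ {n s} → Hyperplane n s → Fin n → Set
Fixed A i = A i ≡ nothing → Data.Empty.⊥
  where import Data.Empty

HasFixedCoord : ∀ {n s} → Hyperplane n s → Set
HasFixedCoord {n} A = Data.Product.Σ (Fin n) (λ i → Fixed A i)
  where import Data.Product

matchᵇ : ∀ {m} → Fin m → Maybe (Fin m) → Bool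
matchᵇ y nothing  = true
matchᵇ y (just a) = isYes (y Fin.≟ a)

_∈H_ : ∀ {n s} → Point n s → Hyperplane n s → Set
q ∈H A = ∀ i → T (matchᵇ (q i) (A i))

_∈Hᵇ_ : ∀ {n s} → Point n s → Hyperplane n s → Bool
_∈Hᵇ_ {n} q A = all (λ i → matchᵇ (q i) (A i)) (allFin n)

isFixedᵇ : ∀ {m} → Maybe (Fin m) → Bool
isFixedᵇ nothing  = false
isFixedᵇ (just _) = true

maxFixedᵇ : ∀ {n s} → Hyperplane n s → Fin n → Bool
maxFixedᵇ {n} A k =
  isFixedᵇ (A k) ∧ all (λ i → if toℕ k ℕ.<ᵇ toℕ i then not (isFixedᵇ (A i)) else true) (allFin n)

consP : ∀ {n} {s : Fin (suc n) → ℕ} → Fin (s zero) → Point n (s ∘ suc) → Point (suc n) s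
consP a p zero    = a
consP a p (suc i) = p i

allPoints : (n : ℕ) (s : Fin n → ℕ) → List (Point n s)
allPoints zero    s = (λ ()) ∷ []
allPoints (suc n) s =
  concatMap (λ a → map (consP a) (allPoints n (s ∘ suc))) (allFin (s zero))

card : (n : ℕ) → (Fin n → ℕ) → ℕ
card n s = foldr ℕ._*_ 1 (map s (allFin n))

fromℕ : ℕ → ℚ
fromℕ m = + m ℚ./ 1

-- Total inverse (junk value 0 at 0; only used where the argument is nonzero).
inv : ℚ → ℚ
inv p with p ≟ℚ 0ℚ
... | yes _  = 0ℚ
... | no p≢0 = ℚ.1/_ p {{ℚ.≢-nonZero p≢0}}

sumℚ : List ℚ → ℚ
sumℚ = foldr _+_ 0ℚ

upd : ∀ {n s} → Point n s → (j : Fin n) → Fin (s j) → Point n s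
upd q j y i with j Fin.≟ i
... | yes refl = y
... | no _     = q i

module Construction {n : ℕ} {s : Fin n → ℕ} (𝒜 : List (Hyperplane n s)) (δ : ℚ) where

  -- q ∈ B_k (k 0-based coordinate); depends only on the first k+1 coordinates of q,
  -- since hyperplanes with max F(A) = k fix no coordinate after k.
  inBᵇ : Fin n → Point n s → Bool
  inBᵇ k q = any (λ A → maxFixedᵇ A k ∧ (q ∈Hᵇ A)) 𝒜

  -- α (for paper index k+1) evaluated at the prefix of q before coordinate k.
  α : Fin n → Point n s → ℚ
  α k q = fromℕ (length (filter (λ y → T? (inBᵇ k (upd q k y))) (allFin (s k))))
          * inv (fromℕ (s k))
    where
      open import Data.Bool.Properties using () renaming (T? to T?)

  -- multiplicative factor passing from ℙ_k to ℙ_{k+1} (paper indices), at coordinate k.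
  factor : Fin n → Point n s → ℚ
  factor k q =
    if inBᵇ k q
    then 0ℚ ⊔ ((α k q - δ) * inv (α k q * (1ℚ - δ)))
    else inv (1ℚ - α k q) ⊓ inv (1ℚ - δ)

  -- ℙ m (q) = ℙ_m extended uniformly to Q, evaluated at q  (0 ≤ m ≤ n).
  ℙ : ℕ → Point n s → ℚ
  ℙ zero q = inv (fromℕ (card n s))
  ℙ (suc m) q with m ℕ.<? n
  ... | yes m<n = factor (Fin.fromℕ< m<n) q * ℙ m q
  ... | no _    = ℙ m q

  -- 𝔼_{k}[α_{k+1}(x)²]  (paper: 𝔼_{k-1}[α_k²] for paper index k = toℕ k + 1),
  -- computed as a sum over Q of the uniformly extended measure.
  𝔼α² : Fin n → ℚ
  𝔼α² k = sumℚ (map (λ q → α k q * α k q * ℙ (toℕ k) q) (allPoints n s))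

  Σ𝔼α² : ℚ
  Σ𝔼α² = sumℚ (map 𝔼α² (allFin n))

-- The weights are chosen so that, over the k-th coordinate, the factor turning ℙₖ₋₁ into ℙₖ
-- averages to one.  Hence a function of the first a coordinates has the same expectation
-- under every ℙₘ with m ≥ a, and in particular ℙₙ is a probability measure.  The set Bₖ
-- depends on the first k coordinates only, so ℙₙ(Bₖ) = ℙₖ(Bₖ); on Bₖ the factor is at most
-- αₖ/(4δ(1−δ)), and averaging it over the k-th coordinate gives
-- ℙₙ(Bₖ) ≤ 𝔼ₖ₋₁[αₖ²]/(4δ(1−δ)).  If 𝒜 covered Q, every point would lie in some Bₖ (k the
-- last fixed coordinate of a hyperplane containing it), so 1 = ℙₙ(Q) ≤ Σₖ ℙₙ(Bₖ), contradicting
-- the hypothesis.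

module Submission where

open import Defs
open import Data.Bool.Base using (Bool; true; false; T; _∧_; if_then_else_; not)
open import Data.Bool.Properties using (T?; T-∧)
open import Data.Bool.ListAction using (and; or)
open import Data.Empty using (⊥; ⊥-elim)
open import Data.Fin.Base as Fin using (Fin; zero; suc; toℕ)
import Data.Fin.Properties as Finₚ
import Data.Integer.Base as ℤ
import Data.Integer.Properties as ℤₚ
open import Data.List.Base using (List; []; _∷_; map; concatMap; allFin; filter; length; _++_; foldr)
import Data.List.Properties as Listₚ
open import Data.List.Membership.Propositional using (_∈_; find; lose)
open import Data.List.Membership.Propositional.Properties using (∈-allFin)
open import Data.List.Relation.Unary.All as All using (All)
open import Data.List.Relation.Unary.All.Properties using (all⁺; all⁻)
open import Data.List.Relation.Unary.Any using (Any; here; there)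
open import Data.List.Relation.Unary.Any.Properties using (any⁺)
open import Data.Maybe.Base using (Maybe; just; nothing)
open import Data.Nat.Base as ℕ using (ℕ; zero; suc; z≤n; s≤s)
import Data.Nat.Coprimality as Coprime
import Data.Nat.Properties as ℕₚ
open import Data.Product.Base using (∃; _,_; _×_; proj₂)
open import Data.Rational using (ℚ; 0ℚ; 1ℚ; ½; mkℚ; _+_; _*_; _-_; -_; _⊔_; _⊓_; _≤_; _<_; positive; nonNegative; nonPositive; ≢-nonZero)
open import Data.Rational.Properties
open import Data.Rational.Solver using (module +-*-Solver)
open import Data.Sum.Base using (_⊎_; inj₁; inj₂)
open import Function.Base using (_∘_)
open import Function.Bundles using (Equivalence)
open import Relation.Binary.Definitions using (Tri; tri<; tri≈; tri>)
open import Relation.Binary.PropositionalEquality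
open import Relation.Nullary.Decidable using (Dec; yes; no; toWitness)
open import Relation.Nullary.Negation using (¬_)

open +-*-Solver

fromℕ≡mkℚ : ∀ m → fromℕ m ≡ mkℚ (ℤ.+ m) 0 (Coprime.sym (Coprime.1-coprimeTo m))
fromℕ≡mkℚ m = normalize-coprime (Coprime.sym (Coprime.1-coprimeTo m))

fromℕ-suc : ∀ m → fromℕ (suc m) ≡ 1ℚ + fromℕ m
fromℕ-suc m rewrite fromℕ≡mkℚ m | fromℕ≡mkℚ (suc m) = sym (trans (/-cong 1+m refl) (fromℕ≡mkℚ (suc m)))
  where
  1+m : ℤ.+ 1 ℤ.* ℤ.+ 1 ℤ.+ ℤ.+ m ℤ.* ℤ.+ 1 ≡ ℤ.+ suc m
  1+m = cong (ℤ._+_ ℤ.1ℤ) (ℤₚ.*-identityʳ (ℤ.+ m))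

fromℕ-nonNeg : ∀ m → 0ℚ ≤ fromℕ m
fromℕ-nonNeg m = nonNegative⁻¹ _ {{normalize-nonNeg m 1}}

fromℕ-pos : ∀ {m} → 0 ℕ.< m → 0ℚ < fromℕ m
fromℕ-pos {suc m} _ = positive⁻¹ _ {{normalize-pos (suc m) 1}}

fromℕ-mono-≤ : ∀ {m k} → m ℕ.≤ k → fromℕ m ≤ fromℕ k
fromℕ-mono-≤ {zero} {k} z≤n = fromℕ-nonNeg k
fromℕ-mono-≤ {suc m} {suc k} (s≤s m≤k) rewrite fromℕ-suc m | fromℕ-suc k = +-monoʳ-≤ 1ℚ (fromℕ-mono-≤ m≤k)

0<1 : 0ℚ < 1ℚ
0<1 = toWitness {a? = 0ℚ <? 1ℚ} _

*-nonNeg : ∀ {p q} → 0ℚ ≤ p → 0ℚ ≤ q → 0ℚ ≤ p * q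
*-nonNeg {p} {q} 0≤p 0≤q = nonNegative⁻¹ _ {{nonNeg*nonNeg⇒nonNeg p {{nonNegative 0≤p}} q {{nonNegative 0≤q}}}}

*-pos : ∀ {p q} → 0ℚ < p → 0ℚ < q → 0ℚ < p * q
*-pos {p} {q} 0<p 0<q = positive⁻¹ _ {{pos*pos⇒pos p {{positive 0<p}} q {{positive 0<q}}}}

*-nonPos-nonNeg : ∀ {p q} → p ≤ 0ℚ → 0ℚ ≤ q → p * q ≤ 0ℚ
*-nonPos-nonNeg {p} {q} p≤0 0≤q = nonPositive⁻¹ _ {{nonPos*nonNeg⇒nonPos p {{nonPositive p≤0}} q {{nonNegative 0≤q}}}}

square-nonNeg : ∀ p → 0ℚ ≤ p * p
square-nonNeg p with ≤-total 0ℚ p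
... | inj₁ 0≤p = *-nonNeg 0≤p 0≤p
... | inj₂ p≤0 = nonNegative⁻¹ _ {{nonPos*nonPos⇒nonPos p {{nonPositive p≤0}} p {{nonPositive p≤0}}}}

p≤q⇒0≤q-p : ∀ {p q} → p ≤ q → 0ℚ ≤ q - p
p≤q⇒0≤q-p {p} {q} p≤q = subst (_≤ q - p) (+-inverseʳ p) (+-monoˡ-≤ (- p) p≤q)

p<q⇒0<q-p : ∀ {p q} → p < q → 0ℚ < q - p
p<q⇒0<q-p {p} {q} p<q = subst (_< q - p) (+-inverseʳ p) (+-monoˡ-< (- p) p<q)

p≤q⇒p-q≤0 : ∀ {p q} → p ≤ q → p - q ≤ 0ℚ
p≤q⇒p-q≤0 {p} {q} p≤q = subst (p - q ≤_) (+-inverseʳ q) (+-monoˡ-≤ (- q) p≤q)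

0≤q-p⇒p≤q : ∀ {p q} → 0ℚ ≤ q - p → p ≤ q
0≤q-p⇒p≤q {p} {q} 0≤q-p =
  subst₂ _≤_ (+-identityˡ p) (solve 2 (λ p q → q :- p :+ p := q) refl p q) (+-monoˡ-≤ p 0≤q-p)

-‿antimonoʳ-≤ : ∀ r {p q} → p ≤ q → r - q ≤ r - p
-‿antimonoʳ-≤ r p≤q = +-monoʳ-≤ r (neg-antimono-≤ p≤q)

inv-inverseʳ : ∀ {p} → 0ℚ < p → p * inv p ≡ 1ℚ
inv-inverseʳ {p} 0<p with p ≟ 0ℚ
... | yes p≡0 = ⊥-elim (<-irrefl (sym p≡0) 0<p)
... | no  p≢0 = *-inverseʳ p {{≢-nonZero p≢0}}

inv-pos : ∀ {p} → 0ℚ < p → 0ℚ < inv p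
inv-pos {p} 0<p with p ≟ 0ℚ
... | yes p≡0 = ⊥-elim (<-irrefl (sym p≡0) 0<p)
... | no  p≢0 = positive⁻¹ _ {{1/pos⇒pos p {{positive 0<p}}}}

-- Also at p = 0ℚ, where inv returns the junk value 0ℚ.
inv-nonNeg : ∀ {p} → 0ℚ ≤ p → 0ℚ ≤ inv p
inv-nonNeg {p} 0≤p with <-cmp 0ℚ p
... | tri< 0<p _ _ = <⇒≤ (inv-pos 0<p)
... | tri≈ _ refl _ = ≤-refl
... | tri> _ _ p<0 = ⊥-elim (<-irrefl refl (<-≤-trans p<0 0≤p))

inv-antimono-≤ : ∀ {p q} → 0ℚ < p → p ≤ q → inv q ≤ inv p
inv-antimono-≤ {p} {q} 0<p p≤q = begin
  inv q                     ≡⟨ sym (trans (cong (inv q *_) (inv-inverseʳ 0<p)) (*-identityʳ (inv q))) ⟩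
  inv q * (p * inv p)       ≡⟨ swap (inv q) p (inv p) ⟩
  (inv q * inv p) * p       ≤⟨ *-monoˡ-≤-nonNeg (inv q * inv p) {{nonNegative 0≤inv}} p≤q ⟩
  (inv q * inv p) * q       ≡⟨ sym (trans (swap (inv p) q (inv q)) (cong (_* q) (*-comm (inv p) (inv q)))) ⟩
  inv p * (q * inv q)       ≡⟨ trans (cong (inv p *_) (inv-inverseʳ (<-≤-trans 0<p p≤q))) (*-identityʳ (inv p)) ⟩
  inv p                     ∎
  where
  open ≤-Reasoning
  swap : ∀ x y z → x * (y * z) ≡ (x * z) * y
  swap = solve 3 (λ x y z → x :* (y :* z) := (x :* z) :* y) refl
  0≤inv = *-nonNeg (inv-nonNeg (≤-trans (<⇒≤ 0<p) p≤q)) (inv-nonNeg (<⇒≤ 0<p))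

inv-distrib-* : ∀ {p q} → 0ℚ < p → 0ℚ < q → inv (p * q) ≡ inv p * inv q
inv-distrib-* {p} {q} 0<p 0<q = begin
  inv (p * q)                                 ≡⟨ sym (*-identityʳ _) ⟩
  inv (p * q) * 1ℚ                            ≡⟨ cong (inv (p * q) *_) (sym pq[p⁻¹q⁻¹]≡1) ⟩
  inv (p * q) * ((p * q) * (inv p * inv q))   ≡⟨ solve 3 (λ x y z → x :* (y :* z) := (y :* x) :* z) refl (inv (p * q)) (p * q) (inv p * inv q) ⟩
  ((p * q) * inv (p * q)) * (inv p * inv q)   ≡⟨ cong (_* (inv p * inv q)) (inv-inverseʳ (*-pos 0<p 0<q)) ⟩
  1ℚ * (inv p * inv q)                        ≡⟨ *-identityˡ _ ⟩
  inv p * inv q                               ∎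
  where
  open ≡-Reasoning
  pq[p⁻¹q⁻¹]≡1 : (p * q) * (inv p * inv q) ≡ 1ℚ
  pq[p⁻¹q⁻¹]≡1 = trans (solve 4 (λ a b x y → (a :* b) :* (x :* y) := (a :* x) :* (b :* y)) refl p q (inv p) (inv q))
                       (cong₂ _*_ (inv-inverseʳ 0<p) (inv-inverseʳ 0<q))

x/z*[z*w]≡x*w : ∀ x {z} w → 0ℚ < z → x * inv z * (z * w) ≡ x * w
x/z*[z*w]≡x*w x {z} w 0<z =
  trans (solve 4 (λ x i z w → x :* i :* (z :* w) := x :* w :* (z :* i)) refl x (inv z) z w)
        (trans (cong (x * w *_) (inv-inverseʳ 0<z)) (*-identityʳ (x * w)))

-- Finite sums and averages

∑ : {A : Set} → List A → (A → ℚ) → ℚ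
∑ xs f = sumℚ (map f xs)

syntax ∑ xs (λ x → e) = ∑[ x ← xs ] e

count : {A : Set} → (A → Bool) → List A → ℕ
count b xs = length (filter (T? ∘ b) xs)

module _ {A : Set} where

  ∑-cong : ∀ (xs : List A) {f g : A → ℚ} → (∀ x → f x ≡ g x) → ∑ xs f ≡ ∑ xs g
  ∑-cong xs f≗g = cong sumℚ (Listₚ.map-cong f≗g xs)

  ∑-++ : ∀ (xs ys : List A) (f : A → ℚ) → ∑ (xs ++ ys) f ≡ ∑ xs f + ∑ ys f
  ∑-++ []       ys f = sym (+-identityˡ _)
  ∑-++ (x ∷ xs) ys f = trans (cong (f x +_) (∑-++ xs ys f)) (sym (+-assoc (f x) _ _))

  ∑-mono-≤ : ∀ (xs : List A) {f g : A → ℚ} → (∀ x → f x ≤ g x) → ∑ xs f ≤ ∑ xs g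
  ∑-mono-≤ []       _   = ≤-refl
  ∑-mono-≤ (x ∷ xs) f≤g = +-mono-≤ (f≤g x) (∑-mono-≤ xs f≤g)

  ∑-nonNeg : ∀ (xs : List A) {f : A → ℚ} → (∀ x → 0ℚ ≤ f x) → 0ℚ ≤ ∑ xs f
  ∑-nonNeg []       _   = ≤-refl
  ∑-nonNeg (x ∷ xs) f≥0 = +-mono-≤ (f≥0 x) (∑-nonNeg xs f≥0)

  ∑-distrib-+ : ∀ (xs : List A) (f g : A → ℚ) → ∑[ x ← xs ] (f x + g x) ≡ ∑ xs f + ∑ xs g
  ∑-distrib-+ []       f g = refl
  ∑-distrib-+ (x ∷ xs) f g =
    trans (cong (f x + g x +_) (∑-distrib-+ xs f g)) (interchange (f x) (g x) (∑ xs f) (∑ xs g))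
    where
    interchange : ∀ a b c d → a + b + (c + d) ≡ a + c + (b + d)
    interchange = solve 4 (λ a b c d → a :+ b :+ (c :+ d) := a :+ c :+ (b :+ d)) refl

  ∑-*ˡ : ∀ (xs : List A) (c : ℚ) (f : A → ℚ) → ∑[ x ← xs ] (c * f x) ≡ c * ∑ xs f
  ∑-*ˡ []       c f = sym (*-zeroʳ c)
  ∑-*ˡ (x ∷ xs) c f = trans (cong (c * f x +_) (∑-*ˡ xs c f)) (sym (*-distribˡ-+ c (f x) (∑ xs f)))

  ∑-*ʳ : ∀ (xs : List A) (c : ℚ) (f : A → ℚ) → ∑[ x ← xs ] (f x * c) ≡ ∑ xs f * c
  ∑-*ʳ xs c f = trans (∑-cong xs (λ x → *-comm (f x) c)) (trans (∑-*ˡ xs c f) (*-comm c _))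

  ∑-const : ∀ (xs : List A) (c : ℚ) → ∑[ _ ← xs ] c ≡ fromℕ (length xs) * c
  ∑-const []       c = sym (*-zeroˡ c)
  ∑-const (x ∷ xs) c = begin
    c + ∑[ _ ← xs ] c            ≡⟨ cong (c +_) (∑-const xs c) ⟩
    c + fromℕ (length xs) * c    ≡⟨ solve 2 (λ c l → c :+ l :* c := (con 1ℚ :+ l) :* c) refl c (fromℕ (length xs)) ⟩
    (1ℚ + fromℕ (length xs)) * c ≡⟨ cong (_* c) (sym (fromℕ-suc (length xs))) ⟩
    fromℕ (suc (length xs)) * c  ∎
    where open ≡-Reasoning

  ∑-if : ∀ (b : A → Bool) (u v : ℚ) (xs : List A) →
    ∑[ x ← xs ] (if b x then u else v)
      ≡ fromℕ (count b xs) * u + (fromℕ (length xs) - fromℕ (count b xs)) * v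
  ∑-if b u v []       = solve 2 (λ u v → con 0ℚ := con 0ℚ :* u :+ (con 0ℚ :- con 0ℚ) :* v) refl u v
  ∑-if b u v (x ∷ xs) with b x
  ... | true  = begin
    u + ∑[ x ← xs ] (if b x then u else v)         ≡⟨ cong (u +_) (∑-if b u v xs) ⟩
    u + (c * u + (l - c) * v)                      ≡⟨ solve 4 (λ c l u v → u :+ (c :* u :+ (l :- c) :* v)
                                                         := (con 1ℚ :+ c) :* u :+ ((con 1ℚ :+ l) :- (con 1ℚ :+ c)) :* v) refl c l u v ⟩
    (1ℚ + c) * u + ((1ℚ + l) - (1ℚ + c)) * v        ≡⟨ sym (cong₂ (λ c′ l′ → c′ * u + (l′ - c′) * v)
                                                         (fromℕ-suc (count b xs)) (fromℕ-suc (length xs))) ⟩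
    fromℕ (suc (count b xs)) * u + (fromℕ (suc (length xs)) - fromℕ (suc (count b xs))) * v ∎
    where
    open ≡-Reasoning
    c = fromℕ (count b xs)
    l = fromℕ (length xs)
  ... | false = begin
    v + ∑[ x ← xs ] (if b x then u else v)         ≡⟨ cong (v +_) (∑-if b u v xs) ⟩
    v + (c * u + (l - c) * v)                      ≡⟨ solve 4 (λ c l u v → v :+ (c :* u :+ (l :- c) :* v)
                                                         := c :* u :+ ((con 1ℚ :+ l) :- c) :* v) refl c l u v ⟩
    c * u + ((1ℚ + l) - c) * v                      ≡⟨ sym (cong (λ l′ → c * u + (l′ - c) * v) (fromℕ-suc (length xs))) ⟩
    c * u + (fromℕ (suc (length xs)) - c) * v       ∎
    where
    open ≡-Reasoning
    c = fromℕ (count b xs)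
    l = fromℕ (length xs)

  count-cong : ∀ {b b′ : A → Bool} (xs : List A) → (∀ x → b x ≡ b′ x) → count b xs ≡ count b′ xs
  count-cong xs b≗b′ =
    cong length (Listₚ.filter-≐ (T? ∘ _) (T? ∘ _) ((λ {x} → subst T (b≗b′ x)) , (λ {x} → subst T (sym (b≗b′ x)))) xs)

  term≤∑ : ∀ {xs : List A} {f : A → ℚ} → (∀ x → 0ℚ ≤ f x) → ∀ {x} → x ∈ xs → f x ≤ ∑ xs f
  term≤∑ {x ∷ xs} {f} f≥0 (here refl) =
    subst (_≤ f x + ∑ xs f) (+-identityʳ (f x)) (+-monoʳ-≤ (f x) (∑-nonNeg xs f≥0))
  term≤∑ {y ∷ xs} {f} f≥0 (there x∈xs) =
    ≤-trans (term≤∑ f≥0 x∈xs) (subst (_≤ f y + ∑ xs f) (+-identityˡ (∑ xs f)) (+-monoˡ-≤ (∑ xs f) (f≥0 y)))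

module _ {A B : Set} where

  ∑-map : ∀ (h : A → B) (xs : List A) (f : B → ℚ) → ∑ (map h xs) f ≡ ∑ xs (f ∘ h)
  ∑-map h xs f = cong sumℚ (sym (Listₚ.map-∘ xs))

  ∑-concatMap : ∀ (g : A → List B) (xs : List A) (f : B → ℚ) →
    ∑ (concatMap g xs) f ≡ ∑[ x ← xs ] ∑ (g x) f
  ∑-concatMap g []       f = refl
  ∑-concatMap g (x ∷ xs) f = trans (∑-++ (g x) (concatMap g xs) f) (cong (∑ (g x) f +_) (∑-concatMap g xs f))

  ∑-comm : ∀ (xs : List A) (ys : List B) (F : A → B → ℚ) →
    ∑[ x ← xs ] ∑[ y ← ys ] F x y ≡ ∑[ y ← ys ] ∑[ x ← xs ] F x y
  ∑-comm []       ys F = sym (trans (∑-const ys 0ℚ) (*-zeroʳ (fromℕ (length ys))))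
  ∑-comm (x ∷ xs) ys F =
    trans (cong (∑ ys (F x) +_) (∑-comm xs ys F)) (sym (∑-distrib-+ ys (F x) (λ y → ∑[ x ← xs ] F x y)))

length-allFin : ∀ m → length (allFin m) ≡ m
length-allFin m = Listₚ.length-tabulate {n = m} (λ i → i)

average : (m : ℕ) → (Fin m → ℚ) → ℚ
average m g = ∑ (allFin m) g * inv (fromℕ m)

proportion : ∀ {m} → (Fin m → Bool) → ℚ
proportion {m} b = fromℕ (count b (allFin m)) * inv (fromℕ m)

module _ {m : ℕ} where

  average-mono-≤ : ∀ {g h : Fin m → ℚ} → (∀ y → g y ≤ h y) → average m g ≤ average m h
  average-mono-≤ g≤h = *-monoʳ-≤-nonNeg _ {{nonNegative (inv-nonNeg (fromℕ-nonNeg m))}} (∑-mono-≤ (allFin m) g≤h)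

  average-cong : ∀ {g h : Fin m → ℚ} → (∀ y → g y ≡ h y) → average m g ≡ average m h
  average-cong g≗h = cong (_* inv (fromℕ m)) (∑-cong (allFin m) g≗h)

  average-*ˡ : ∀ c (g : Fin m → ℚ) → average m (λ y → c * g y) ≡ c * average m g
  average-*ˡ c g = trans (cong (_* inv (fromℕ m)) (∑-*ˡ (allFin m) c g)) (*-assoc c _ _)

  ∑-allFin-average : 0 ℕ.< m → ∀ (g : Fin m → ℚ) → ∑[ _ ← allFin m ] average m g ≡ ∑ (allFin m) g
  ∑-allFin-average m>0 g = begin
    ∑[ _ ← allFin m ] average m g             ≡⟨ ∑-const (allFin m) (average m g) ⟩
    fromℕ (length (allFin m)) * average m g   ≡⟨ cong (λ l → fromℕ l * average m g) (length-allFin m) ⟩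
    fromℕ m * (∑ (allFin m) g * inv (fromℕ m)) ≡⟨ cong (fromℕ m *_) (*-comm (∑ (allFin m) g) _) ⟩
    fromℕ m * (inv (fromℕ m) * ∑ (allFin m) g) ≡⟨ sym (*-assoc (fromℕ m) _ _) ⟩
    fromℕ m * inv (fromℕ m) * ∑ (allFin m) g  ≡⟨ cong (_* ∑ (allFin m) g) (inv-inverseʳ (fromℕ-pos m>0)) ⟩
    1ℚ * ∑ (allFin m) g                       ≡⟨ *-identityˡ _ ⟩
    ∑ (allFin m) g                            ∎
    where open ≡-Reasoning

  proportion-nonNeg : ∀ (b : Fin m → Bool) → 0ℚ ≤ proportion b
  proportion-nonNeg b = *-nonNeg (fromℕ-nonNeg (count b (allFin m))) (inv-nonNeg (fromℕ-nonNeg m))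

  proportion≤1 : 0 ℕ.< m → ∀ (b : Fin m → Bool) → proportion b ≤ 1ℚ
  proportion≤1 m>0 b = begin
    fromℕ (count b (allFin m)) * inv (fromℕ m) ≤⟨ *-monoʳ-≤-nonNeg _ {{nonNegative (inv-nonNeg (fromℕ-nonNeg m))}} (fromℕ-mono-≤ count≤m) ⟩
    fromℕ m * inv (fromℕ m)                    ≡⟨ inv-inverseʳ (fromℕ-pos m>0) ⟩
    1ℚ                                         ∎
    where
    open ≤-Reasoning
    count≤m : count b (allFin m) ℕ.≤ m
    count≤m = subst (count b (allFin m) ℕ.≤_) (length-allFin m) (Listₚ.length-filter (T? ∘ b) (allFin m))

  average-if : 0 ℕ.< m → ∀ (b : Fin m → Bool) u v →
    average m (λ y → if b y then u else v) ≡ proportion b * u + (1ℚ - proportion b) * v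
  average-if m>0 b u v = begin
    ∑[ y ← allFin m ] (if b y then u else v) * i          ≡⟨ cong (_* i) (∑-if b u v (allFin m)) ⟩
    (c * u + (fromℕ (length (allFin m)) - c) * v) * i     ≡⟨ cong (λ l → (c * u + (fromℕ l - c) * v) * i) (length-allFin m) ⟩
    (c * u + (fromℕ m - c) * v) * i                       ≡⟨ solve 5 (λ c M i u v → (c :* u :+ (M :- c) :* v) :* i
                                                              := (c :* i) :* u :+ (M :* i :- c :* i) :* v) refl c (fromℕ m) i u v ⟩
    (c * i) * u + (fromℕ m * i - c * i) * v               ≡⟨ cong (λ one → (c * i) * u + (one - c * i) * v) (inv-inverseʳ (fromℕ-pos m>0)) ⟩
    (c * i) * u + (1ℚ - c * i) * v                        ∎
    where
    open ≡-Reasoning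
    c = fromℕ (count b (allFin m))
    i = inv (fromℕ m)

𝟙 : Bool → ℚ
𝟙 b = if b then 1ℚ else 0ℚ

𝟙-nonNeg : ∀ b → 0ℚ ≤ 𝟙 b
𝟙-nonNeg true  = <⇒≤ 0<1
𝟙-nonNeg false = ≤-refl

𝟙-true : ∀ {b} → T b → 𝟙 b ≡ 1ℚ
𝟙-true {true} _ = refl

-- The weights

module Weights (δ : ℚ) where

  inWeight : ℚ → ℚ
  inWeight a = 0ℚ ⊔ ((a - δ) * inv (a * (1ℚ - δ)))

  outWeight : ℚ → ℚ
  outWeight a = inv (1ℚ - a) ⊓ inv (1ℚ - δ)

  -- weight b a is the paper's ratio ℙₖ(x,y)·|Sₖ| / ℙₖ₋₁(x) for a = αₖ(x), with b telling
  -- whether (x,y) ∈ Bₖ.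
  weight : Bool → ℚ → ℚ
  weight b a = if b then inWeight a else outWeight a

  module _ (0<δ : 0ℚ < δ) (δ<1 : δ < 1ℚ) where

    0<1-δ : 0ℚ < 1ℚ - δ
    0<1-δ = p<q⇒0<q-p δ<1

    weight-nonNeg : ∀ b {a} → a ≤ 1ℚ → 0ℚ ≤ weight b a
    weight-nonNeg true  {a} _ = p≤p⊔q 0ℚ ((a - δ) * inv (a * (1ℚ - δ)))
    weight-nonNeg false a≤1 = ⊓-glb (inv-nonNeg (p≤q⇒0≤q-p a≤1)) (inv-nonNeg (<⇒≤ 0<1-δ))

    inWeight≤ : ∀ {a} → 0ℚ ≤ a → inWeight a ≤ a * inv (fromℕ 4 * δ * (1ℚ - δ))
    inWeight≤ {a} 0≤a = ⊔-lub 0≤a/E (ratio≤ (<-cmp 0ℚ a))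
      where
      E = fromℕ 4 * δ * (1ℚ - δ)
      0<E : 0ℚ < E
      0<E = *-pos (*-pos (fromℕ-pos {4} (s≤s z≤n)) 0<δ) 0<1-δ
      0≤a/E : 0ℚ ≤ a * inv E
      0≤a/E = *-nonNeg 0≤a (inv-nonNeg (<⇒≤ 0<E))
      ratio≤ : Tri (0ℚ < a) (0ℚ ≡ a) (a < 0ℚ) → (a - δ) * inv (a * (1ℚ - δ)) ≤ a * inv E
      ratio≤ (tri> _ _ a<0)  = ⊥-elim (<-irrefl refl (<-≤-trans a<0 0≤a))
      ratio≤ (tri≈ _ refl _) =
        ≤-trans (≤-reflexive (trans (cong (λ d → (0ℚ - δ) * inv d) (*-zeroˡ (1ℚ - δ))) (*-zeroʳ (0ℚ - δ)))) 0≤a/E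
      ratio≤ (tri< 0<a _ _)  = *-cancelʳ-≤-pos (D * E) {{positive (*-pos 0<D 0<E)}} (begin
        (a - δ) * inv D * (D * E)  ≡⟨ x/z*[z*w]≡x*w (a - δ) E 0<D ⟩
        (a - δ) * E                ≤⟨ 0≤q-p⇒p≤q (subst (0ℚ ≤_) (sym gap) (*-nonNeg (<⇒≤ 0<1-δ) (square-nonNeg (a - (δ + δ))))) ⟩
        a * D                      ≡⟨ sym (trans (cong (a * inv E *_) (*-comm D E)) (x/z*[z*w]≡x*w a D 0<E)) ⟩
        a * inv E * (D * E)        ∎)
        where
        open ≤-Reasoning
        D = a * (1ℚ - δ)
        0<D = *-pos 0<a 0<1-δ
        -- The whole inequality is this completed square.
        gap : a * D - (a - δ) * E ≡ (1ℚ - δ) * ((a - (δ + δ)) * (a - (δ + δ)))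
        gap = solve 2 (λ a d → a :* (a :* (con 1ℚ :- d)) :- (a :- d) :* (con (fromℕ 4) :* d :* (con 1ℚ :- d))
                         := (con 1ℚ :- d) :* ((a :- (d :+ d)) :* (a :- (d :+ d)))) refl a δ

    weights-average≡1 : ∀ {a} → 0ℚ ≤ a → a ≤ 1ℚ → a * inWeight a + (1ℚ - a) * outWeight a ≡ 1ℚ
    weights-average≡1 {a} 0≤a a≤1 = by-cases (<-cmp a δ)
      where
      open ≡-Reasoning
      F = inv (1ℚ - δ)
      X = (a - δ) * inv (a * (1ℚ - δ))
      [1-a]outWeight : δ ≤ a → (1ℚ - a) * outWeight a ≡ (1ℚ - a) * F
      [1-a]outWeight δ≤a with <-cmp a 1ℚ
      ... | tri< a<1 _ _ =
        cong ((1ℚ - a) *_) (p≥q⇒p⊓q≡q (inv-antimono-≤ (p<q⇒0<q-p a<1) (-‿antimonoʳ-≤ 1ℚ δ≤a)))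
      ... | tri≈ _ refl _ = trans (*-zeroˡ (outWeight 1ℚ)) (sym (*-zeroˡ F))
      ... | tri> _ _ 1<a = ⊥-elim (<-irrefl refl (<-≤-trans 1<a a≤1))
      above : δ ≤ a → a * inWeight a + (1ℚ - a) * outWeight a ≡ 1ℚ
      above δ≤a = begin
        a * inWeight a + (1ℚ - a) * outWeight a  ≡⟨ cong₂ (λ u v → a * u + v) (p≤q⇒p⊔q≡q 0≤X) ([1-a]outWeight δ≤a) ⟩
        a * X + (1ℚ - a) * F                     ≡⟨ cong (_+ (1ℚ - a) * F) aX ⟩
        (a - δ) * F + (1ℚ - a) * F               ≡⟨ solve 3 (λ a d f → (a :- d) :* f :+ (con 1ℚ :- a) :* f := (con 1ℚ :- d) :* f) refl a δ F ⟩
        (1ℚ - δ) * F                             ≡⟨ inv-inverseʳ 0<1-δ ⟩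
        1ℚ                                       ∎
        where
        0<a = <-≤-trans 0<δ δ≤a
        0≤X : 0ℚ ≤ X
        0≤X = *-nonNeg (p≤q⇒0≤q-p δ≤a) (inv-nonNeg (*-nonNeg 0≤a (<⇒≤ 0<1-δ)))
        aX : a * X ≡ (a - δ) * F
        aX = begin
          a * ((a - δ) * inv (a * (1ℚ - δ)))  ≡⟨ cong (λ i → a * ((a - δ) * i)) (inv-distrib-* 0<a 0<1-δ) ⟩
          a * ((a - δ) * (inv a * F))         ≡⟨ solve 4 (λ a b i f → a :* (b :* (i :* f)) := (a :* i) :* (b :* f)) refl a (a - δ) (inv a) F ⟩
          (a * inv a) * ((a - δ) * F)         ≡⟨ trans (cong (_* ((a - δ) * F)) (inv-inverseʳ 0<a)) (*-identityˡ _) ⟩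
          (a - δ) * F                         ∎
      by-cases : Tri (a < δ) (a ≡ δ) (δ < a) → a * inWeight a + (1ℚ - a) * outWeight a ≡ 1ℚ
      by-cases (tri< a<δ _ _) = begin
        a * inWeight a + (1ℚ - a) * outWeight a
          ≡⟨ cong₂ (λ u v → a * u + (1ℚ - a) * v) (p≥q⇒p⊔q≡p X≤0) (p≤q⇒p⊓q≡p (inv-antimono-≤ 0<1-δ (-‿antimonoʳ-≤ 1ℚ (<⇒≤ a<δ)))) ⟩
        a * 0ℚ + (1ℚ - a) * inv (1ℚ - a)
          ≡⟨ cong₂ _+_ (*-zeroʳ a) (inv-inverseʳ (p<q⇒0<q-p (<-trans a<δ δ<1))) ⟩
        1ℚ ∎
        where
        X≤0 : X ≤ 0ℚ
        X≤0 = *-nonPos-nonNeg (p≤q⇒p-q≤0 (<⇒≤ a<δ)) (inv-nonNeg (*-nonNeg 0≤a (<⇒≤ 0<1-δ)))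
      by-cases (tri≈ _ a≡δ _) = above (≤-reflexive (sym a≡δ))
      by-cases (tri> _ _ δ<a) = above (<⇒≤ δ<a)

-- Points and coordinate updates

infix 4 _≐_
_≐_ : ∀ {n s} → Point n s → Point n s → Set
q ≐ r = ∀ i → q i ≡ r i

Extensional : ∀ {n s} {A : Set} → (Point n s → A) → Set
Extensional f = ∀ {q r} → q ≐ r → f q ≡ f r

DependsOnFirst : ∀ {n s} {A : Set} → ℕ → (Point n s → A) → Set
DependsOnFirst {n} m f = ∀ (j : Fin n) → m ℕ.≤ toℕ j → ∀ q y → f (upd q j y) ≡ f q

DependsOnFirst-weaken : ∀ {n s} {A : Set} {a b} {f : Point n s → A} → a ℕ.≤ b → DependsOnFirst a f → DependsOnFirst b f
DependsOnFirst-weaken a≤b f-local j b≤j = f-local j (ℕₚ.≤-trans a≤b b≤j)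

module _ {n : ℕ} {s : Fin n → ℕ} where

  upd-updates : ∀ (q : Point n s) j y → upd q j y j ≡ y
  upd-updates q j y with j Finₚ.≟ j
  ... | yes refl = refl
  ... | no  j≢j  = ⊥-elim (j≢j refl)

  upd-minimal : ∀ (q : Point n s) {j i} y → j ≢ i → upd q j y i ≡ q i
  upd-minimal q {j} {i} y j≢i with j Finₚ.≟ i
  ... | yes refl = ⊥-elim (j≢i refl)
  ... | no  _    = refl

  upd-cong : ∀ {q r : Point n s} j y → q ≐ r → upd q j y ≐ upd r j y
  upd-cong j y q≐r i with j Finₚ.≟ i
  ... | yes refl = refl
  ... | no  _    = q≐r i

  upd-idem : ∀ (q : Point n s) j z y → upd (upd q j z) j y ≐ upd q j y
  upd-idem q j z y i with j Finₚ.≟ i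
  ... | yes refl = refl
  ... | no  j≢i  = upd-minimal q z j≢i

  upd-comm : ∀ (q : Point n s) {j k} z y → j ≢ k → upd (upd q j z) k y ≐ upd (upd q k y) j z
  upd-comm q {j} {k} z y j≢k i with j Finₚ.≟ i | k Finₚ.≟ i
  ... | yes refl | yes refl = ⊥-elim (j≢k refl)
  ... | yes refl | no  _    = upd-updates q i z
  ... | no  _    | yes refl = sym (upd-updates q i y)
  ... | no  j≢i  | no  k≢i  = trans (upd-minimal q z j≢i) (sym (upd-minimal q y k≢i))

module _ {n : ℕ} {s : Fin (suc n) → ℕ} where

  consP-cong : ∀ a {p r : Point n (s ∘ suc)} → p ≐ r → consP {s = s} a p ≐ consP a r
  consP-cong a p≐r zero    = refl
  consP-cong a p≐r (suc i) = p≐r i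

  upd-consP-zero : ∀ a (p : Point n (s ∘ suc)) y → upd (consP {s = s} a p) zero y ≐ consP y p
  upd-consP-zero a p y zero    = upd-updates (consP {s = s} a p) zero y
  upd-consP-zero a p y (suc i) = upd-minimal (consP {s = s} a p) {zero} {suc i} y (λ ())

  upd-consP-suc : ∀ a (p : Point n (s ∘ suc)) k y → upd (consP {s = s} a p) (suc k) y ≐ consP a (upd p k y)
  upd-consP-suc a p k y zero = upd-minimal (consP {s = s} a p) {suc k} {zero} y (λ ())
  upd-consP-suc a p k y (suc i) = by-cases (k Finₚ.≟ i)
    where
    by-cases : Dec (k ≡ i) → upd (consP {s = s} a p) (suc k) y (suc i) ≡ upd p k y i
    by-cases (yes refl) = trans (upd-updates (consP {s = s} a p) (suc k) y) (sym (upd-updates p k y))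
    by-cases (no k≢i)   = trans (upd-minimal (consP {s = s} a p) y (k≢i ∘ Finₚ.suc-injective)) (sym (upd-minimal p y k≢i))

∑-allPoints-suc : ∀ {n} {s : Fin (suc n) → ℕ} (f : Point (suc n) s → ℚ) →
  ∑ (allPoints (suc n) s) f ≡ ∑[ a ← allFin (s zero) ] ∑[ p ← allPoints n (s ∘ suc) ] f (consP a p)
∑-allPoints-suc {n} {s} f =
  trans (∑-concatMap _ (allFin (s zero)) f) (∑-cong (allFin (s zero)) (λ a → ∑-map (consP a) (allPoints n (s ∘ suc)) f))

card-suc : ∀ n (s : Fin (suc n) → ℕ) → card (suc n) s ≡ s zero ℕ.* card n (s ∘ suc)
card-suc n s = cong (λ sizes → s zero ℕ.* foldr ℕ._*_ 1 sizes)
  (trans (Listₚ.map-tabulate suc s) (sym (Listₚ.map-tabulate (λ i → i) (s ∘ suc))))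

card-pos : ∀ n (s : Fin n → ℕ) → (∀ i → 0 ℕ.< s i) → 0 ℕ.< card n s
card-pos zero    s s>0 = s≤s z≤n
card-pos (suc n) s s>0 =
  subst (0 ℕ.<_) (sym (card-suc n s)) (ℕₚ.*-mono-≤ (s>0 zero) (card-pos n (s ∘ suc) (s>0 ∘ suc)))

length-allPoints : ∀ n (s : Fin n → ℕ) → length (allPoints n s) ≡ card n s
length-allPoints zero    s = refl
length-allPoints (suc n) s = begin
  length (allPoints (suc n) s)                          ≡⟨ length-blocks (allFin (s zero)) ⟩
  length (allFin (s zero)) ℕ.* length (allPoints n (s ∘ suc)) ≡⟨ cong₂ ℕ._*_ (length-allFin (s zero)) (length-allPoints n (s ∘ suc)) ⟩
  s zero ℕ.* card n (s ∘ suc)                           ≡⟨ sym (card-suc n s) ⟩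
  card (suc n) s                                        ∎
  where
  open ≡-Reasoning
  P = allPoints n (s ∘ suc)
  length-blocks : ∀ as → length (concatMap (λ a → map (consP {s = s} a) P) as) ≡ length as ℕ.* length P
  length-blocks []       = refl
  length-blocks (a ∷ as) =
    trans (Listₚ.length-++ (map (consP {s = s} a) P)) (cong₂ ℕ._+_ (Listₚ.length-map (consP {s = s} a) P) (length-blocks as))

∑-average-coordinate : ∀ n (s : Fin n → ℕ) (k : Fin n) → 0 ℕ.< s k → (f : Point n s → ℚ) → Extensional f →
  ∑ (allPoints n s) f ≡ ∑[ q ← allPoints n s ] average (s k) (λ y → f (upd q k y))
∑-average-coordinate (suc n) s zero s₀>0 f f-ext = sym (begin
  ∑[ q ← allPoints (suc n) s ] average (s zero) (λ y → f (upd q zero y))    ≡⟨ ∑-allPoints-suc (λ q → average (s zero) (λ y → f (upd q zero y))) ⟩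
  ∑[ a ← A ] ∑[ p ← P ] average (s zero) (λ y → f (upd (consP a p) zero y)) ≡⟨ ∑-cong A (λ a → ∑-cong P (λ p →
                                                                               average-cong (λ y → f-ext (upd-consP-zero a p y)))) ⟩
  ∑[ a ← A ] ∑[ p ← P ] average (s zero) (λ y → f (consP y p))              ≡⟨ ∑-cong A (λ _ → ∑-*ʳ P _ _) ⟩
  ∑[ a ← A ] ((∑[ p ← P ] ∑[ y ← A ] f (consP y p)) * inv (fromℕ (s zero))) ≡⟨ ∑-cong A (λ _ → cong (_* inv (fromℕ (s zero))) (∑-comm P A _)) ⟩
  ∑[ a ← A ] average (s zero) (λ y → ∑[ p ← P ] f (consP y p))              ≡⟨ ∑-allFin-average s₀>0 _ ⟩
  ∑[ y ← A ] ∑[ p ← P ] f (consP y p)                                      ≡⟨ ∑-allPoints-suc f ⟨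
  ∑ (allPoints (suc n) s) f                                                ∎)
  where
  open ≡-Reasoning
  A = allFin (s zero)
  P = allPoints n (s ∘ suc)
∑-average-coordinate (suc n) s (suc k) sₖ>0 f f-ext = begin
  ∑ (allPoints (suc n) s) f                                                  ≡⟨ ∑-allPoints-suc f ⟩
  ∑[ a ← A ] ∑[ p ← P ] f (consP a p)                                        ≡⟨ ∑-cong A (λ a →
                                                                                 ∑-average-coordinate n (s ∘ suc) k sₖ>0 (f ∘ consP a) (f-ext ∘ consP-cong a)) ⟩
  ∑[ a ← A ] ∑[ p ← P ] average (s (suc k)) (λ y → f (consP a (upd p k y)))  ≡⟨ ∑-cong A (λ a → ∑-cong P (λ p →
                                                                                 average-cong (λ y → f-ext (upd-consP-suc a p k y)))) ⟨
  ∑[ a ← A ] ∑[ p ← P ] average (s (suc k)) (λ y → f (upd (consP a p) (suc k) y)) ≡⟨ ∑-allPoints-suc (λ q → average (s (suc k)) (λ y → f (upd q (suc k) y))) ⟨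
  ∑[ q ← allPoints (suc n) s ] average (s (suc k)) (λ y → f (upd q (suc k) y)) ∎
  where
  open ≡-Reasoning
  A = allFin (s zero)
  P = allPoints n (s ∘ suc)

-- Hyperplanes

last-witness : ∀ {n} {P : Fin n → Set} → (∀ i → Dec (P i)) → ∀ i → P i →
  ∃ λ k → P k × (∀ j → toℕ k ℕ.< toℕ j → ¬ P j)
last-witness {suc n} {P} P? i Pi = search-tail (Finₚ.any? (P? ∘ suc))
  where
  search-tail : Dec (∃ (P ∘ suc)) → ∃ λ k → P k × (∀ j → toℕ k ℕ.< toℕ j → ¬ P j)
  search-tail (yes (i′ , Pi′)) with last-witness (P? ∘ suc) i′ Pi′
  ... | k , Pk , k-last = suc k , Pk , later
    where
    later : ∀ (j : Fin (suc n)) → toℕ (suc k) ℕ.< toℕ j → ¬ P j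
    later (suc j) k<j = k-last j (ℕ.s<s⁻¹ k<j)
  search-tail (no ¬tail) = zero , P₀ i Pi , later
    where
    P₀ : ∀ i → P i → P zero
    P₀ zero    Pi = Pi
    P₀ (suc i) Pi = ⊥-elim (¬tail (i , Pi))
    later : ∀ (j : Fin (suc n)) → 0 ℕ.< toℕ j → ¬ P j
    later (suc j) _ Pj = ¬tail (j , Pj)

module _ {n : ℕ} {s : Fin n → ℕ} (A : Hyperplane n s) where

  maxFixed-free : ∀ {k j} → T (maxFixedᵇ A k) → toℕ k ℕ.< toℕ j → A j ≡ nothing
  maxFixed-free {k} {j} max k<j =
    free (All.lookup (all⁺ _ (allFin n) (proj₂ (Equivalence.to T-∧ max))) (∈-allFin j))
    where
    free : T (if toℕ k ℕ.<ᵇ toℕ j then not (isFixedᵇ (A j)) else true) → A j ≡ nothing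
    free t with toℕ k ℕ.<ᵇ toℕ j | ℕₚ.<⇒<ᵇ k<j | A j
    ... | true | _ | nothing = refl
    ... | true | _ | just _  = ⊥-elim t

  maxFixed-exists : HasFixedCoord A → ∃ λ k → T (maxFixedᵇ A k)
  maxFixed-exists (i , i-fixed) =
    let k , k-fixed , k-last = last-witness (λ i → T? (isFixedᵇ (A i))) i (fixed⇒isFixedᵇ (A i) i-fixed)
    in k , Equivalence.from T-∧ (k-fixed , all⁻ _ (All.universal (free-after k-last) (allFin n)))
    where
    fixed⇒isFixedᵇ : ∀ {m} (a : Maybe (Fin m)) → (a ≡ nothing → ⊥) → T (isFixedᵇ a)
    fixed⇒isFixedᵇ nothing  a≢nothing = a≢nothing refl
    fixed⇒isFixedᵇ (just _) _         = _
    free-after : ∀ {k} → (∀ j → toℕ k ℕ.< toℕ j → ¬ T (isFixedᵇ (A j))) →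
      ∀ j → T (if toℕ k ℕ.<ᵇ toℕ j then not (isFixedᵇ (A j)) else true)
    free-after {k} k-last j with toℕ k ℕ.<ᵇ toℕ j in k<ᵇj
    ... | false = _
    ... | true with isFixedᵇ (A j) | k-last j (ℕₚ.<ᵇ⇒< (toℕ k) (toℕ j) (subst T (sym k<ᵇj) _))
    ...   | true  | ¬fixed = ¬fixed _
    ...   | false | _      = _

-- The measures ℙₘ

module Measure {n : ℕ} {s : Fin n → ℕ} (𝒜 : List (Hyperplane n s)) (δ : ℚ) where

  open Construction 𝒜 δ
  open Weights δ

  -- α k q is definitionally proportion (λ y → inBᵇ k (upd q k y)), and factor k q is
  -- weight (inBᵇ k q) (α k q).

  Q : List (Point n s)
  Q = allPoints n s

  ∈Hᵇ-cong : ∀ (A : Hyperplane n s) → Extensional (_∈Hᵇ A)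
  ∈Hᵇ-cong A q≐r = cong and (Listₚ.map-cong (λ i → cong (λ z → matchᵇ z (A i)) (q≐r i)) (allFin n))

  inB-cong : ∀ k → Extensional (inBᵇ k)
  inB-cong k q≐r = cong or (Listₚ.map-cong (λ A → cong (maxFixedᵇ A k ∧_) (∈Hᵇ-cong A q≐r)) 𝒜)

  inB-local : ∀ k → DependsOnFirst (suc (toℕ k)) (inBᵇ k)
  inB-local k j k<j q y = cong or (Listₚ.map-cong unchanged 𝒜)
    where
    unchanged : ∀ A → maxFixedᵇ A k ∧ (upd q j y ∈Hᵇ A) ≡ maxFixedᵇ A k ∧ (q ∈Hᵇ A)
    unchanged A with maxFixedᵇ A k in max
    ... | false = refl
    ... | true  = cong and (Listₚ.map-cong match (allFin n))
      where
      match : ∀ i → matchᵇ (upd q j y i) (A i) ≡ matchᵇ (q i) (A i)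
      match i with j Finₚ.≟ i
      ... | yes refl rewrite maxFixed-free A (subst T (sym max) _) k<j = refl
      ... | no  _    = refl

  α-cong′ : ∀ k {q r} → (∀ y → inBᵇ k (upd q k y) ≡ inBᵇ k (upd r k y)) → α k q ≡ α k r
  α-cong′ k same = cong (λ c → fromℕ c * inv (fromℕ (s k))) (count-cong (allFin (s k)) same)

  α-cong : ∀ k → Extensional (α k)
  α-cong k q≐r = α-cong′ k (λ y → inB-cong k (upd-cong k y q≐r))

  α-local : ∀ k → DependsOnFirst (toℕ k) (α k)
  α-local k j k≤j q z = by-cases (ℕₚ.m≤n⇒m<n∨m≡n k≤j)
    where
    same-coordinate : ∀ {j} → k ≡ j → (z : Fin (s j)) → α k (upd q j z) ≡ α k q
    same-coordinate refl z = α-cong′ k (λ y → inB-cong k (upd-idem q k z y))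
    by-cases : toℕ k ℕ.< toℕ j ⊎ toℕ k ≡ toℕ j → α k (upd q j z) ≡ α k q
    by-cases (inj₁ k<j) = α-cong′ k (λ y → trans (inB-cong k (upd-comm q z y j≢k)) (inB-local k j k<j (upd q k y) z))
      where
      j≢k : j ≢ k
      j≢k refl = ℕₚ.<-irrefl refl k<j
    by-cases (inj₂ k≡j) = same-coordinate (Finₚ.toℕ-injective k≡j) z

  factor-cong : ∀ k → Extensional (factor k)
  factor-cong k q≐r = cong₂ weight (inB-cong k q≐r) (α-cong k q≐r)

  factor-local : ∀ k → DependsOnFirst (suc (toℕ k)) (factor k)
  factor-local k j k<j q y = cong₂ weight (inB-local k j k<j q y) (DependsOnFirst-weaken (ℕₚ.n≤1+n _) (α-local k) j k<j q y)

  -- Reasoning about ℙ (suc m) goes through ℙ-step: with-abstraction over m <? n in a goal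
  -- containing the factors would normalise them, which is very slow.
  ℙ-step : ∀ m → Dec (m ℕ.< n) → Point n s → ℚ
  ℙ-step m (yes m<n) q = factor (Fin.fromℕ< m<n) q * ℙ m q
  ℙ-step m (no  _)   q = ℙ m q

  ℙ-suc≡ℙ-step : ∀ m q → ℙ (suc m) q ≡ ℙ-step m (m ℕₚ.<? n) q
  ℙ-suc≡ℙ-step m q with m ℕₚ.<? n
  ... | yes _ = refl
  ... | no  _ = refl

  ℙ-suc : ∀ {m} (m<n : m ℕ.< n) q → ℙ (suc m) q ≡ factor (Fin.fromℕ< m<n) q * ℙ m q
  ℙ-suc {m} m<n q = trans (ℙ-suc≡ℙ-step m q) (step (m ℕₚ.<? n))
    where
    step : ∀ d → ℙ-step m d q ≡ factor (Fin.fromℕ< m<n) q * ℙ m q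
    step (yes _)   = refl
    step (no  m≮n) = ⊥-elim (m≮n m<n)

  ℙ-cong : ∀ m → Extensional (ℙ m)
  ℙ-cong zero    q≐r = refl
  ℙ-cong (suc m) {q} {r} q≐r = trans (ℙ-suc≡ℙ-step m q) (trans (step (m ℕₚ.<? n)) (sym (ℙ-suc≡ℙ-step m r)))
    where
    step : ∀ d → ℙ-step m d q ≡ ℙ-step m d r
    step (yes m<n) = cong₂ _*_ (factor-cong (Fin.fromℕ< m<n) q≐r) (ℙ-cong m q≐r)
    step (no  _)   = ℙ-cong m q≐r

  ℙ-local : ∀ m → DependsOnFirst m (ℙ m)
  ℙ-local zero    j _   q y = refl
  ℙ-local (suc m) j m<j q y = trans (ℙ-suc≡ℙ-step m (upd q j y)) (trans (step (m ℕₚ.<? n)) (sym (ℙ-suc≡ℙ-step m q)))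
    where
    step : ∀ d → ℙ-step m d (upd q j y) ≡ ℙ-step m d q
    step (yes m<n) = cong₂ _*_ (factor-local (Fin.fromℕ< m<n) j (subst (ℕ._< toℕ j) (sym (Finₚ.toℕ-fromℕ< m<n)) m<j) q y)
                               (ℙ-local m j (ℕₚ.<⇒≤ m<j) q y)
    step (no  _)   = ℙ-local m j (ℕₚ.<⇒≤ m<j) q y

  covered⇒inB : All HasFixedCoord 𝒜 → ∀ q → Any (q ∈H_) 𝒜 → ∃ λ k → T (inBᵇ k q)
  covered⇒inB fixed q q∈⋃𝒜 =
    let A , A∈𝒜 , q∈A = find q∈⋃𝒜
        k , k-max     = maxFixed-exists A (All.lookup fixed A∈𝒜)
    in k , any⁺ _ (lose A∈𝒜 (Equivalence.from T-∧ (k-max , all⁻ _ (All.universal q∈A (allFin n)))))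

  𝔼 : ℕ → (Point n s → ℚ) → ℚ
  𝔼 m g = ∑[ q ← Q ] (g q * ℙ m q)

  𝔼-∑ : ∀ m {A : Set} (xs : List A) (g : A → Point n s → ℚ) →
    𝔼 m (λ q → ∑[ x ← xs ] g x q) ≡ ∑[ x ← xs ] 𝔼 m (g x)
  𝔼-∑ m xs g = trans (∑-cong Q (λ q → sym (∑-*ʳ xs (ℙ m q) (λ x → g x q)))) (∑-comm Q xs (λ q x → g x q * ℙ m q))

  module _ (s>0 : ∀ i → 0 ℕ.< s i) (0<δ : 0ℚ < δ) (δ<1 : δ < 1ℚ) where

    α≤1 : ∀ k q → α k q ≤ 1ℚ
    α≤1 k q = proportion≤1 (s>0 k) (λ y → inBᵇ k (upd q k y))

    ℙ-nonNeg : ∀ m q → 0ℚ ≤ ℙ m q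
    ℙ-nonNeg zero    q = inv-nonNeg (fromℕ-nonNeg (card n s))
    ℙ-nonNeg (suc m) q = subst (0ℚ ≤_) (sym (ℙ-suc≡ℙ-step m q)) (step (m ℕₚ.<? n))
      where
      step : ∀ d → 0ℚ ≤ ℙ-step m d q
      step (yes m<n) = *-nonNeg (weight-nonNeg 0<δ δ<1 (inBᵇ k q) (α≤1 k q)) (ℙ-nonNeg m q)
        where k = Fin.fromℕ< m<n
      step (no  _)   = ℙ-nonNeg m q

    𝔼-mono-≤ : ∀ m {g h : Point n s → ℚ} → (∀ q → g q ≤ h q) → 𝔼 m g ≤ 𝔼 m h
    𝔼-mono-≤ m g≤h = ∑-mono-≤ Q (λ q → *-monoʳ-≤-nonNeg (ℙ m q) {{nonNegative (ℙ-nonNeg m q)}} (g≤h q))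

    average-factor≡1 : ∀ k q → average (s k) (λ y → factor k (upd q k y)) ≡ 1ℚ
    average-factor≡1 k q = begin
      average (s k) (λ y → weight (b y) (α k (upd q k y)))         ≡⟨ average-cong (λ y → cong (weight (b y)) (α-local k k ℕₚ.≤-refl q y)) ⟩
      average (s k) (λ y → weight (b y) (α k q))                   ≡⟨ average-if (s>0 k) b (inWeight (α k q)) (outWeight (α k q)) ⟩
      α k q * inWeight (α k q) + (1ℚ - α k q) * outWeight (α k q)  ≡⟨ weights-average≡1 0<δ δ<1 (proportion-nonNeg b) (α≤1 k q) ⟩
      1ℚ                                                           ∎
      where
      open ≡-Reasoning
      b : Fin (s k) → Bool
      b y = inBᵇ k (upd q k y)

    𝔼-suc : ∀ {m} (m<n : m ℕ.< n) {g : Point n s → ℚ} → Extensional g → DependsOnFirst m g → 𝔼 (suc m) g ≡ 𝔼 m g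
    𝔼-suc {m} m<n {g} g-cong g-local = begin
      ∑[ q ← Q ] (g q * ℙ (suc m) q)                                         ≡⟨ ∑-cong Q (λ q → cong (g q *_) (ℙ-suc m<n q)) ⟩
      ∑ Q h                                                                  ≡⟨ ∑-average-coordinate n s j (s>0 j) h h-cong ⟩
      ∑[ q ← Q ] average (s j) (λ y → h (upd q j y))                         ≡⟨ ∑-cong Q (λ q →
                                                                                  trans (average-cong (h-upd q))
                                                                                        (average-*ˡ (g q * ℙ m q) (λ y → factor j (upd q j y)))) ⟩
      ∑[ q ← Q ] ((g q * ℙ m q) * average (s j) (λ y → factor j (upd q j y))) ≡⟨ ∑-cong Q (λ q →
                                                                                  trans (cong ((g q * ℙ m q) *_) (average-factor≡1 j q)) (*-identityʳ _)) ⟩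
      ∑[ q ← Q ] (g q * ℙ m q)                                               ∎
      where
      open ≡-Reasoning
      j = Fin.fromℕ< m<n
      m≤j : m ℕ.≤ toℕ j
      m≤j = ℕₚ.≤-reflexive (sym (Finₚ.toℕ-fromℕ< m<n))
      h : Point n s → ℚ
      h q = g q * (factor j q * ℙ m q)
      h-cong : Extensional h
      h-cong q≐r = cong₂ _*_ (g-cong q≐r) (cong₂ _*_ (factor-cong j q≐r) (ℙ-cong m q≐r))
      h-upd : ∀ q y → h (upd q j y) ≡ (g q * ℙ m q) * factor j (upd q j y)
      h-upd q y = trans (cong₂ (λ u v → u * (factor j (upd q j y) * v)) (g-local j m≤j q y) (ℙ-local m j m≤j q y))
                        (solve 3 (λ u f v → u :* (f :* v) := (u :* v) :* f) refl (g q) (factor j (upd q j y)) (ℙ m q))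

    𝔼-stable : ∀ {a m} {g : Point n s → ℚ} → a ℕ.≤ m → m ℕ.≤ n → Extensional g → DependsOnFirst a g → 𝔼 m g ≡ 𝔼 a g
    𝔼-stable {m = zero}  z≤n   _     _      _       = refl
    𝔼-stable {a} {suc m} {g} a≤1+m 1+m≤n g-cong g-local = by-cases (ℕₚ.m≤n⇒m<n∨m≡n a≤1+m)
      where
      by-cases : a ℕ.< suc m ⊎ a ≡ suc m → 𝔼 (suc m) g ≡ 𝔼 a g
      by-cases (inj₁ a<1+m) = trans (𝔼-suc 1+m≤n g-cong (DependsOnFirst-weaken a≤m g-local))
                                    (𝔼-stable a≤m (ℕₚ.<⇒≤ 1+m≤n) g-cong g-local)
        where
        a≤m = ℕ.s≤s⁻¹ a<1+m
      by-cases (inj₂ refl)  = refl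

    total-mass : 𝔼 n (λ _ → 1ℚ) ≡ 1ℚ
    total-mass = begin
      𝔼 n (λ _ → 1ℚ)                                  ≡⟨ 𝔼-stable {g = λ _ → 1ℚ} z≤n ℕₚ.≤-refl (λ _ → refl) (λ _ _ _ _ → refl) ⟩
      ∑[ _ ← Q ] (1ℚ * ℙ₀)                            ≡⟨ ∑-const Q (1ℚ * ℙ₀) ⟩
      fromℕ (length Q) * (1ℚ * ℙ₀)                    ≡⟨ cong₂ _*_ (cong fromℕ (length-allPoints n s)) (*-identityˡ ℙ₀) ⟩
      fromℕ (card n s) * ℙ₀                           ≡⟨ inv-inverseʳ (fromℕ-pos (card-pos n s s>0)) ⟩
      1ℚ                                              ∎
      where
      open ≡-Reasoning
      ℙ₀ = inv (fromℕ (card n s))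

    𝔼-inB≤ : ∀ k → 𝔼 n (𝟙 ∘ inBᵇ k) ≤ inv (fromℕ 4 * δ * (1ℚ - δ)) * 𝔼α² k
    𝔼-inB≤ k = begin
      𝔼 n I                                                        ≡⟨ 𝔼-stable (Finₚ.toℕ<n k) ℕₚ.≤-refl I-cong I-local ⟩
      𝔼 (suc (toℕ k)) I                                            ≡⟨ ∑-cong Q (λ q → cong (I q *_) (ℙ-suc-toℕ q)) ⟩
      ∑ Q h                                                        ≡⟨ ∑-average-coordinate n s k (s>0 k) h h-cong ⟩
      ∑[ q ← Q ] average (s k) (λ y → h (upd q k y))               ≤⟨ ∑-mono-≤ Q (λ q → average-mono-≤ (bound q)) ⟩
      ∑[ q ← Q ] average (s k) (λ y → if b q y then a q * C * P q else 0ℚ)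
                                                                   ≡⟨ ∑-cong Q (λ q → average-if (s>0 k) (b q) (a q * C * P q) 0ℚ) ⟩
      ∑[ q ← Q ] (a q * (a q * C * P q) + (1ℚ - a q) * 0ℚ)         ≡⟨ ∑-cong Q (λ q → solve 3 (λ a c p → a :* (a :* c :* p) :+ (con 1ℚ :- a) :* con 0ℚ
                                                                                                := c :* (a :* a :* p)) refl (a q) C (P q)) ⟩
      ∑[ q ← Q ] (C * (a q * a q * P q))                           ≡⟨ ∑-*ˡ Q C (λ q → a q * a q * P q) ⟩
      C * 𝔼α² k                                                    ∎
      where
      open ≤-Reasoning
      C = inv (fromℕ 4 * δ * (1ℚ - δ))
      I = 𝟙 ∘ inBᵇ k
      a = α k
      P = ℙ (toℕ k)
      b : Point n s → Fin (s k) → Bool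
      b q y = inBᵇ k (upd q k y)
      I-cong : Extensional I
      I-cong q≐r = cong 𝟙 (inB-cong k q≐r)
      I-local : DependsOnFirst (suc (toℕ k)) I
      I-local j k<j q y = cong 𝟙 (inB-local k j k<j q y)
      ℙ-suc-toℕ : ∀ q → ℙ (suc (toℕ k)) q ≡ factor k q * P q
      ℙ-suc-toℕ q = trans (ℙ-suc (Finₚ.toℕ<n k) q) (cong (λ i → factor i q * P q) (Finₚ.fromℕ<-toℕ k (Finₚ.toℕ<n k)))
      h : Point n s → ℚ
      h q = I q * (factor k q * P q)
      h-cong : Extensional h
      h-cong q≐r = cong₂ _*_ (I-cong q≐r) (cong₂ _*_ (factor-cong k q≐r) (ℙ-cong (toℕ k) q≐r))
      bound : ∀ q y → h (upd q k y) ≤ (if b q y then a q * C * P q else 0ℚ)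
      bound q y = subst (_≤ (if b q y then a q * C * P q else 0ℚ)) (sym (cong₂ (λ u v → 𝟙 (b q y) * (weight (b q y) u * v))
                                       (α-local k k ℕₚ.≤-refl q y) (ℙ-local (toℕ k) k ℕₚ.≤-refl q y)))
                               (by-cases (b q y))
        where
        by-cases : ∀ c → 𝟙 c * (weight c (a q) * P q) ≤ (if c then a q * C * P q else 0ℚ)
        by-cases true  = ≤-trans (≤-reflexive (*-identityˡ _))
                                 (*-monoʳ-≤-nonNeg (P q) {{nonNegative (ℙ-nonNeg (toℕ k) q)}}
                                   (inWeight≤ 0<δ δ<1 (proportion-nonNeg (b q))))
        by-cases false = ≤-reflexive (*-zeroˡ (weight false (a q) * P q))

    cover⇒1≤ : All HasFixedCoord 𝒜 → (∀ q → Any (q ∈H_) 𝒜) → 1ℚ ≤ inv (fromℕ 4 * δ * (1ℚ - δ)) * Σ𝔼α²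
    cover⇒1≤ fixed cover = begin
      1ℚ                                             ≡⟨ total-mass ⟨
      𝔼 n (λ _ → 1ℚ)                                 ≤⟨ 𝔼-mono-≤ n 1≤∑𝟙 ⟩
      𝔼 n (λ q → ∑[ k ← allFin n ] 𝟙 (inBᵇ k q))     ≡⟨ 𝔼-∑ n (allFin n) (λ k → 𝟙 ∘ inBᵇ k) ⟩
      ∑[ k ← allFin n ] 𝔼 n (𝟙 ∘ inBᵇ k)             ≤⟨ ∑-mono-≤ (allFin n) 𝔼-inB≤ ⟩
      ∑[ k ← allFin n ] (C * 𝔼α² k)                  ≡⟨ ∑-*ˡ (allFin n) C 𝔼α² ⟩
      C * Σ𝔼α²                                       ∎
      where
      open ≤-Reasoning
      C = inv (fromℕ 4 * δ * (1ℚ - δ))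
      1≤∑𝟙 : ∀ q → 1ℚ ≤ ∑[ k ← allFin n ] 𝟙 (inBᵇ k q)
      1≤∑𝟙 q =
        let k , q∈Bₖ = covered⇒inB fixed q (cover q)
        in subst (_≤ _) (𝟙-true q∈Bₖ) (term≤∑ (λ k → 𝟙-nonNeg (inBᵇ k q)) (∈-allFin k))

lemma3p2 : (n : ℕ) → 1 ℕ.≤ n → (s : Fin n → ℕ) → (∀ i → 2 ℕ.≤ s i) →
    (δ : ℚ) → 0ℚ < δ → δ ≤ ½ →
    (𝒜 : List (Hyperplane n s)) → All HasFixedCoord 𝒜 →
    inv (fromℕ 4 * δ * (1ℚ - δ)) * Construction.Σ𝔼α² 𝒜 δ < 1ℚ →
    ¬ (∀ (q : Point n s) → Any (q ∈H_) 𝒜)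
lemma3p2 n _ s s≥2 δ 0<δ δ≤½ 𝒜 fixed small cover =
  <-irrefl refl (<-≤-trans small (Measure.cover⇒1≤ 𝒜 δ s>0 0<δ δ<1 fixed cover))
  where
  s>0 : ∀ i → 0 ℕ.< s i
  s>0 i = ℕₚ.≤-trans (s≤s z≤n) (s≥2 i)
  δ<1 : δ < 1ℚ
  δ<1 = ≤-<-trans δ≤½ (toWitness {a? = ½ <? 1ℚ} _)
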